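{- Let $n\ge2$, $r\ge1$, $p\ge1$ be integers. Then $$\begin{vmatrix}F^{(n)}_{r-n+2}&F^{(n)}_{r-n+3}&\cdots&F^{(n)}_{r}&F^{(n)}_{p+r}\\ F^{(n)}_{r-n+3}&F^{(n)}_{r-n+4}&\cdots&F^{(n)}_{r+1}&F^{(n)}_{p+r+1}\\ \vdots&\vdots&\cdots&\vdots&\vdots\\ F^{(n)}_{r}&F^{(n)}_{r+1}&\cdots&F^{(n)}_{r+n-2}&F^{(n)}_{p+r+n-2}\\ F^{(n)}_{r+p}&F^{(n)}_{r+p+1}&\cdots&F^{(n)}_{r+p+n-2}&F^{(n)}_{2p+r+n-2} \end{vmatrix}=(-1)^{(n-1)r+\lfloor n/2\rfloor}\cdot \big[F^{(n)}_{p}\big]^2,$$ i.e. the $n\times n$ determinant with entries $F^{(n)}_{r-n+i+j}$ for $1\le i,j\le n-1$, $(i,n)$ entry $F^{(n)}_{p+r+i-1}$ for $1\le i\le n-1$, $(n,j)$ entry $F^{(n)}_{p+r+j-1}$ for $1\le j\le n-1$, and $(n,n)$ entry $F^{(n)}_{2p+r+n-2}$.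
   Context: For an integer $n\ge2$, the $n$-step Fibonacci numbers $F^{(n)}_k$, $k\ge -(n-2)$, are defined by $F^{(n)}_k=0$ for $-(n-2)\le k\le 0$, $F^{(n)}_1=1$, and $F^{(n)}_k=F^{(n)}_{k-1}+F^{(n)}_{k-2}+\cdots+F^{(n)}_{k-n}$ for $k\ge2$. Thus $F^{(n)}_1=F^{(n)}_2=1$, $F^{(n)}_3=2$, …, $F^{(n)}_{n+1}=2^{n-1}$. $\lfloor x\rfloor$ denotes the integer part of $x$. -}

module Defs where

open import Data.Nat as ℕ using (ℕ; zero; suc; _<ᵇ_)
open import Data.Nat.DivMod using (_/_)
open import Data.Integer as ℤ using (ℤ; +_; -[1+_])
open import Data.Fin as Fin using (Fin; toℕ; punchIn)
open import Data.List as List using (List; []; _∷_; replicate; take; head)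
open import Data.Maybe using (Maybe; just; nothing)
open import Data.Nat.ListAction using (sum)
open import Data.Bool using (if_then_else_)

-- Window of n consecutive n-step Fibonacci numbers:
-- fibWindow n k = [F_{k+1}, F_k, ..., F_{k+2-n}]  (length n).
-- Start (k = 0): [F_1, F_0, ..., F_{2-n}] = [1, 0, ..., 0].
-- Step: F_{k+2} = F_{k+1} + ... + F_{k+2-n}, i.e. the sum of the window.
fibWindow : ℕ → ℕ → List ℕ
fibWindow n zero    = take n (1 ∷ replicate n 0)
fibWindow n (suc k) = let w = fibWindow n k in take n (sum w ∷ w)

headOr0 : List ℕ → ℕ
headOr0 []      = 0
headOr0 (x ∷ _) = x

-- n-step Fibonacci number F^{(n)}_k for an integer index k.
-- For k ≤ 0 the value is 0 (matches the definition on -(n-2) ≤ k ≤ 0;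
-- indices below -(n-2) never occur in the theorem).
F : ℕ → ℤ → ℕ
F n (+ zero)  = 0
F n (+ suc k) = headOr0 (fibWindow n k)
F n -[1+ _ ]  = 0

∑ : (m : ℕ) → (Fin m → ℤ) → ℤ
∑ zero    f = + 0
∑ (suc m) f = f Fin.zero ℤ.+ ∑ m (λ i → f (Fin.suc i))

det : (m : ℕ) → (Fin m → Fin m → ℤ) → ℤ
det zero    A = + 1
det (suc m) A =
  ∑ (suc m) (λ j → (ℤ.- + 1) ℤ.^ toℕ j ℤ.* A Fin.zero j
                     ℤ.* det m (λ i k → A (Fin.suc i) (punchIn j k)))

-- The n×n matrix of the theorem, with 1-based indices i = toℕ a + 1,
-- j = toℕ b + 1:
--   (i,j), i,j ≤ n-1 : F_{r-n+i+j}
--   (i,n), i ≤ n-1   : F_{p+r+i-1}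
--   (n,j), j ≤ n-1   : F_{p+r+j-1}
--   (n,n)            : F_{2p+r+n-2}
entry : (n r p : ℕ) → ℕ → ℕ → ℕ
entry n r p i j =
  if i ℕ.<ᵇ n then
    (if j ℕ.<ᵇ n then F n (+ r ℤ.- + n ℤ.+ + i ℤ.+ + j)
                 else F n (+ p ℤ.+ + r ℤ.+ + i ℤ.- + 1))
  else
    (if j ℕ.<ᵇ n then F n (+ p ℤ.+ + r ℤ.+ + j ℤ.- + 1)
                 else F n (+ 2 ℤ.* + p ℤ.+ + r ℤ.+ + n ℤ.- + 2))

M : (n r p : ℕ) → Fin n → Fin n → ℤ
M n r p a b = + entry n r p (suc (toℕ a)) (suc (toℕ b))

-- Write m = n − 1 and e t = F (t + 1 − m): then e vanishes below m, e m = 1, and e (t + n) is the sum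
-- e t + ⋯ + e (t + m). With P = p + n − 2 and the offsets c = (0, 1, …, m − 1, P), the matrix of the
-- theorem is (e (r + c a + c b)). Let H u = det (e (u + a + c b)). Replacing its last row by
-- (e (u + t + c b)) multiplies it by e t: below m the new row repeats an earlier one, at m nothing changes,
-- and beyond m the recurrence together with linearity in the last row lowers t. The same expansion of the
-- last row of H (u + 1) leaves the rows of H u in cyclic order, so H (u + 1) = (−1)^m H u, and expanding
-- H 0 along its first row leaves an anti-triangular minor, so H 0 = (−1)^m e P (−1)^⌊m/2⌋. Hence the
-- determinant is e P (−1)^(m r) (−1)^m e P (−1)^⌊m/2⌋ = (−1)^((n−1) r + ⌊n/2⌋) (F p)².

module Submission where

open import Defs
open import Data.Nat as ℕ using (ℕ; _≤_)
open import Data.Nat.DivMod using (_/_)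
open import Data.Integer as ℤ using (ℤ; +_)
open import Relation.Binary.PropositionalEquality using (_≡_)

import Data.Integer.Properties as ℤP
open import Algebra.Properties.AbelianGroup ℤP.+-0-abelianGroup using (inverseʳ-unique; identityʳ-unique)
import Algebra.Properties.Semiring.Sum ℤP.+-*-semiring as Σℤ
open import Data.Bool using (true; false)
open import Data.Empty using (⊥-elim)
open import Data.Fin using (Fin; toℕ; fromℕ; fromℕ<; inject₁; punchIn; punchOut) renaming (zero to fzero; suc to fsuc)
import Data.Fin.Properties as FinP
open import Data.Fin.Relation.Unary.Top using (view; ‵fromℕ; ‵inject₁)
open import Data.Integer using (0ℤ; 1ℤ; -1ℤ; _+_; _*_; -_; _-_; _^_)
open import Data.Integer.Tactic.RingSolver using (solve-∀)
open import Data.List using (List; _∷_; take; replicate; applyDownFrom)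
open import Data.Nat using (zero; suc; _<ᵇ_)
open import Data.Nat.DivMod using (m/n≡1+[m∸n]/n)
open import Data.Nat.Induction using (<-rec)
open import Data.Nat.ListAction using (sum)
import Data.Nat.Properties as ℕP
open import Data.Vec.Functional as Vector using (updateAt; insertAt; tail)
open import Data.Vec.Functional.Properties
  using (updateAt-updates; updateAt-minimal; updateAt-id-local; insertAt-lookup; insertAt-punchIn)
open import Function using (_∘_; const)
open import Relation.Binary.Definitions using (tri<; tri≈; tri>)
open import Relation.Binary.PropositionalEquality
open import Relation.Nullary using (yes; no)

-- Finite sums

∑≡sum : ∀ m (f : Fin m → ℤ) → ∑ m f ≡ Σℤ.sum f
∑≡sum zero    f = refl
∑≡sum (suc m) f = cong (_+_ (f fzero)) (∑≡sum m (f ∘ fsuc))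

∑-cong : ∀ m {f g : Fin m → ℤ} → f ≗ g → ∑ m f ≡ ∑ m g
∑-cong zero    f≗g = refl
∑-cong (suc m) f≗g = cong₂ _+_ (f≗g fzero) (∑-cong m (f≗g ∘ fsuc))

∑-zero : ∀ m {f : Fin m → ℤ} → (∀ i → f i ≡ 0ℤ) → ∑ m f ≡ 0ℤ
∑-zero zero    f≗0 = refl
∑-zero (suc m) f≗0 = cong₂ _+_ (f≗0 fzero) (∑-zero m (f≗0 ∘ fsuc))

∑-neg : ∀ m (f : Fin m → ℤ) → ∑ m (λ i → - f i) ≡ - ∑ m f
∑-neg zero    f = refl
∑-neg (suc m) f = trans (cong (_+_ (- f fzero)) (∑-neg m (f ∘ fsuc))) (sym (ℤP.neg-distrib-+ (f fzero) _))

∑-+ : ∀ m (f g : Fin m → ℤ) → ∑ m (λ i → f i + g i) ≡ ∑ m f + ∑ m g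
∑-+ m f g rewrite ∑≡sum m (λ i → f i + g i) | ∑≡sum m f | ∑≡sum m g = Σℤ.∑-distrib-+ f g

∑-*ˡ : ∀ m c (f : Fin m → ℤ) → ∑ m (λ i → c * f i) ≡ c * ∑ m f
∑-*ˡ m c f rewrite ∑≡sum m (λ i → c * f i) | ∑≡sum m f = sym (Σℤ.*-distribˡ-sum c f)

∑-*ʳ : ∀ m c (f : Fin m → ℤ) → ∑ m (λ i → f i * c) ≡ ∑ m f * c
∑-*ʳ m c f rewrite ∑≡sum m (λ i → f i * c) | ∑≡sum m f = sym (Σℤ.*-distribʳ-sum c f)

∑-remove : ∀ m (f : Fin (suc m) → ℤ) j → ∑ (suc m) f ≡ f j + ∑ m (f ∘ punchIn j)
∑-remove m f j rewrite ∑≡sum (suc m) f | ∑≡sum m (f ∘ punchIn j) = Σℤ.sum-remove {i = j} f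

∑-init-last : ∀ m (f : Fin (suc m) → ℤ) → ∑ (suc m) f ≡ ∑ m (f ∘ inject₁) + f (fromℕ m)
∑-init-last m f rewrite ∑≡sum (suc m) f | ∑≡sum m (f ∘ inject₁) = Σℤ.sum-init-last f

∑-comm : ∀ m n (f : Fin m → Fin n → ℤ) → ∑ m (λ i → ∑ n (f i)) ≡ ∑ n (λ j → ∑ m (λ i → f i j))
∑-comm m n f = begin
  ∑ m (λ i → ∑ n (f i))                 ≡⟨ ∑-cong m (λ i → ∑≡sum n (f i)) ⟩
  ∑ m (λ i → Σℤ.sum (f i))              ≡⟨ ∑≡sum m _ ⟩
  Σℤ.sum (λ i → Σℤ.sum (f i))           ≡⟨ Σℤ.∑-comm f ⟩
  Σℤ.sum (λ j → Σℤ.sum (λ i → f i j))   ≡⟨ ∑≡sum n _ ⟨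
  ∑ n (λ j → Σℤ.sum (λ i → f i j))      ≡⟨ ∑-cong n (λ j → ∑≡sum m (λ i → f i j)) ⟨
  ∑ n (λ j → ∑ m (λ i → f i j))         ∎
  where open ≡-Reasoning

∑-single : ∀ m (f : Fin (suc m) → ℤ) j → (∀ k → f (punchIn j k) ≡ 0ℤ) → ∑ (suc m) f ≡ f j
∑-single m f j f≗0 = begin
  ∑ (suc m) f                   ≡⟨ ∑-remove m f j ⟩
  f j + ∑ m (f ∘ punchIn j)     ≡⟨ cong (_+_ (f j)) (∑-zero m f≗0) ⟩
  f j + 0ℤ                      ≡⟨ ℤP.+-identityʳ (f j) ⟩
  f j                           ∎
  where open ≡-Reasoning

≡-neg⇒≡0 : ∀ {x} → x ≡ - x → x ≡ 0ℤ
≡-neg⇒≡0 {+ zero}  _  = refl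
≡-neg⇒≡0 {+ suc _} ()
≡-neg⇒≡0 {ℤ.-[1+ _ ]} ()

∑∑-antisymmetric : ∀ m (g : Fin m → Fin m → ℤ) → (∀ i j → g i j ≡ - g j i) → ∑ m (λ i → ∑ m (g i)) ≡ 0ℤ
∑∑-antisymmetric m g anti = ≡-neg⇒≡0 (begin
  ∑ m (λ i → ∑ m (g i))              ≡⟨ ∑-cong m (λ i → ∑-cong m (anti i)) ⟩
  ∑ m (λ i → ∑ m (λ j → - g j i))    ≡⟨ ∑-cong m (λ i → ∑-neg m (λ j → g j i)) ⟩
  ∑ m (λ i → - ∑ m (λ j → g j i))    ≡⟨ ∑-neg m _ ⟩
  - ∑ m (λ i → ∑ m (λ j → g j i))    ≡⟨ cong -_ (∑-comm m m (λ i j → g j i)) ⟩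
  - ∑ m (λ j → ∑ m (g j))            ∎)
  where open ≡-Reasoning

-- Cofactor expansion

Row : ℕ → Set
Row n = Fin n → ℤ

Matrix : ℕ → Set
Matrix n = Fin n → Row n

sign : ∀ {n} → Fin n → ℤ
sign j = -1ℤ ^ toℕ j

minor : ∀ {n} → Matrix (suc n) → Fin (suc n) → Matrix n
minor A j i = A (fsuc i) ∘ punchIn j

expansionTerm : ∀ {n} → Matrix (suc n) → Fin (suc n) → ℤ
expansionTerm {n} A j = sign j * A fzero j * det n (minor A j)

det-cong : ∀ n {A B : Matrix n} → (∀ i → A i ≗ B i) → det n A ≡ det n B
det-cong zero    A≗B = refl
det-cong (suc n) A≗B = ∑-cong (suc n) λ j →
  cong₂ (λ a d → sign j * a * d) (A≗B fzero j) (det-cong n λ i t → A≗B (fsuc i) (punchIn j t))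

AgreeOff : ∀ {n} → Fin n → Matrix n → Matrix n → Set
AgreeOff k A B = ∀ i → i ≢ k → A i ≗ B i

minor-agreeOff : ∀ {n k} {A B : Matrix (suc n)} j → AgreeOff (fsuc k) A B → AgreeOff k (minor A j) (minor B j)
minor-agreeOff j A≈B i i≢k t = A≈B (fsuc i) (i≢k ∘ FinP.suc-injective) (punchIn j t)

det-additive : ∀ n (A B C : Matrix n) k → (∀ t → A k t ≡ B k t + C k t) →
               AgreeOff k A B → AgreeOff k A C → det n A ≡ det n B + det n C
det-additive (suc n) A B C k Aₖ A≈B A≈C =
  trans (∑-cong (suc n) (split k Aₖ A≈B A≈C)) (∑-+ (suc n) (expansionTerm B) (expansionTerm C))
  where
  distribʳ : ∀ s x y d → s * (x + y) * d ≡ s * x * d + s * y * d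
  distribʳ = solve-∀
  split : ∀ k → (∀ t → A k t ≡ B k t + C k t) → AgreeOff k A B → AgreeOff k A C →
          ∀ j → expansionTerm A j ≡ expansionTerm B j + expansionTerm C j
  split fzero Aₖ A≈B A≈C j = begin
    sign j * A fzero j * det n (minor A j)
      ≡⟨ cong (λ a → sign j * a * det n (minor A j)) (Aₖ j) ⟩
    sign j * (B fzero j + C fzero j) * det n (minor A j)
      ≡⟨ distribʳ (sign j) (B fzero j) (C fzero j) _ ⟩
    sign j * B fzero j * det n (minor A j) + sign j * C fzero j * det n (minor A j)
      ≡⟨ cong₂ (λ d d′ → sign j * B fzero j * d + sign j * C fzero j * d′)
           (det-cong n λ i t → A≈B (fsuc i) (λ ()) (punchIn j t))
           (det-cong n λ i t → A≈C (fsuc i) (λ ()) (punchIn j t)) ⟩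
    expansionTerm B j + expansionTerm C j ∎
    where open ≡-Reasoning
  split (fsuc k) Aₖ A≈B A≈C j = begin
    sign j * A fzero j * det n (minor A j)
      ≡⟨ cong (sign j * A fzero j *_) (det-additive n (minor A j) (minor B j) (minor C j) k
           (Aₖ ∘ punchIn j) (minor-agreeOff j A≈B) (minor-agreeOff j A≈C)) ⟩
    sign j * A fzero j * (det n (minor B j) + det n (minor C j))
      ≡⟨ ℤP.*-distribˡ-+ (sign j * A fzero j) _ _ ⟩
    sign j * A fzero j * det n (minor B j) + sign j * A fzero j * det n (minor C j)
      ≡⟨ cong₂ (λ b c → sign j * b * det n (minor B j) + sign j * c * det n (minor C j))
           (A≈B fzero (λ ()) j) (A≈C fzero (λ ()) j) ⟩
    expansionTerm B j + expansionTerm C j ∎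
    where open ≡-Reasoning

-- Repeated rows and row swaps

sign-punchOut : ∀ {n} {j b : Fin (suc n)} (j≢b : j ≢ b) (b≢j : b ≢ j) →
                sign j * sign (punchOut j≢b) ≡ - (sign b * sign (punchOut b≢j))
sign-punchOut {j = fzero} {fzero} j≢b _ = ⊥-elim (j≢b refl)
sign-punchOut {suc n} {fzero} {fsuc b} _ _ = lemma (sign b)
  where
  lemma : ∀ y → 1ℤ * y ≡ - (-1ℤ * y * 1ℤ)
  lemma = solve-∀
sign-punchOut {suc n} {fsuc j} {fzero} _ _ = lemma (sign j)
  where
  lemma : ∀ y → -1ℤ * y * 1ℤ ≡ - (1ℤ * y)
  lemma = solve-∀
sign-punchOut {suc n} {fsuc j} {fsuc b} j≢b b≢j = begin
  (-1ℤ * sign j) * (-1ℤ * sign j′)      ≡⟨ -1*-1* (sign j) (sign j′) ⟩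
  sign j * sign j′                      ≡⟨ sign-punchOut (j≢b ∘ cong fsuc) (b≢j ∘ cong fsuc) ⟩
  - (sign b * sign b′)                  ≡⟨ cong -_ (-1*-1* (sign b) (sign b′)) ⟨
  - ((-1ℤ * sign b) * (-1ℤ * sign b′))  ∎
  where
  open ≡-Reasoning
  j′ b′ : Fin n
  j′ = punchOut (j≢b ∘ cong fsuc)
  b′ = punchOut (b≢j ∘ cong fsuc)
  -1*-1* : ∀ x y → (-1ℤ * x) * (-1ℤ * y) ≡ x * y
  -1*-1* = solve-∀

punchIn-punchOut-comm : ∀ {n} {j b : Fin (suc (suc n))} (j≢b : j ≢ b) (b≢j : b ≢ j) (t : Fin n) →
                        punchIn j (punchIn (punchOut j≢b) t) ≡ punchIn b (punchIn (punchOut b≢j) t)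
punchIn-punchOut-comm {j = fzero} {fzero} j≢b _ t = ⊥-elim (j≢b refl)
punchIn-punchOut-comm {j = fzero} {fsuc b} _ _ t = refl
punchIn-punchOut-comm {j = fsuc j} {fzero} _ _ t = refl
punchIn-punchOut-comm {suc n} {fsuc j} {fsuc b} _ _ fzero = refl
punchIn-punchOut-comm {suc n} {fsuc j} {fsuc b} j≢b b≢j (fsuc t) =
  cong fsuc (punchIn-punchOut-comm (j≢b ∘ cong fsuc) (b≢j ∘ cong fsuc) t)

-- Expanding along row 0 and then along row 1, the pair of columns (j, b) taken by these rows
-- contributes pairTerm j b; when the two rows agree, exchanging j and b only flips its sign.
module EqualFirstRows {n : ℕ} (A : Matrix (suc (suc n))) where

  lowerMinor : (Fin n → Fin (suc (suc n))) → ℤ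
  lowerMinor φ = det n (λ i → A (fsuc (fsuc i)) ∘ φ)

  pairTerm : Fin (suc (suc n)) → Fin (suc (suc n)) → ℤ
  pairTerm j b with j FinP.≟ b
  ... | yes _   = 0ℤ
  ... | no j≢b = sign j * sign (punchOut j≢b) * A fzero j * A fzero b
                   * lowerMinor (punchIn j ∘ punchIn (punchOut j≢b))

  innerTerm : Fin (suc (suc n)) → Fin (suc n) → ℤ
  innerTerm j k = sign k * A fzero (punchIn j k) * lowerMinor (punchIn j ∘ punchIn k)

  pairTerm-diag : ∀ j → pairTerm j j ≡ 0ℤ
  pairTerm-diag j with j FinP.≟ j
  ... | yes _   = refl
  ... | no j≢j = ⊥-elim (j≢j refl)

  pairTerm-punchIn : ∀ j k → pairTerm j (punchIn j k) ≡ sign j * A fzero j * innerTerm j k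
  pairTerm-punchIn j k with j FinP.≟ punchIn j k
  ... | yes j≡jₖ = ⊥-elim (FinP.punchInᵢ≢i j k (sym j≡jₖ))
  ... | no j≢jₖ =
    trans (cong (λ k′ → sign j * sign k′ * A fzero j * A fzero (punchIn j k) * lowerMinor (punchIn j ∘ punchIn k′))
                (trans (FinP.punchOut-cong j refl) (FinP.punchOut-punchIn j)))
          (reassoc (sign j) (sign k) (A fzero j) (A fzero (punchIn j k)) _)
    where
    reassoc : ∀ s t x y d → s * t * x * y * d ≡ s * x * (t * y * d)
    reassoc = solve-∀

  pairTerm-antisym : ∀ j b → pairTerm j b ≡ - pairTerm b j
  pairTerm-antisym j b with j FinP.≟ b | b FinP.≟ j
  ... | yes _   | yes _   = refl
  ... | yes j≡b | no b≢j = ⊥-elim (b≢j (sym j≡b))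
  ... | no j≢b | yes b≡j = ⊥-elim (j≢b (sym b≡j))
  ... | no j≢b | no b≢j =
    trans (cong₂ (λ σ d → σ * A fzero j * A fzero b * d) (sign-punchOut j≢b b≢j)
                 (det-cong n λ i t → cong (A (fsuc (fsuc i))) (punchIn-punchOut-comm j≢b b≢j t)))
          (swap (sign b * sign (punchOut b≢j)) (A fzero j) (A fzero b) _)
    where
    swap : ∀ σ x y d → - σ * x * y * d ≡ - (σ * y * x * d)
    swap = solve-∀

  det-equalFirstRows : A fzero ≗ A (fsuc fzero) → det (suc (suc n)) A ≡ 0ℤ
  det-equalFirstRows A₀≗A₁ = begin
    ∑ (suc (suc n)) (expansionTerm A)                      ≡⟨ ∑-cong (suc (suc n)) expandRow ⟩
    ∑ (suc (suc n)) (λ j → ∑ (suc (suc n)) (pairTerm j))   ≡⟨ ∑∑-antisymmetric (suc (suc n)) pairTerm pairTerm-antisym ⟩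
    0ℤ                                                     ∎
    where
    open ≡-Reasoning
    expandRow : ∀ j → expansionTerm A j ≡ ∑ (suc (suc n)) (pairTerm j)
    expandRow j = begin
      sign j * A fzero j * det (suc n) (minor A j)
        ≡⟨ cong (sign j * A fzero j *_) (∑-cong (suc n) λ k →
             cong (λ a → sign k * a * lowerMinor (punchIn j ∘ punchIn k)) (sym (A₀≗A₁ (punchIn j k)))) ⟩
      sign j * A fzero j * ∑ (suc n) (innerTerm j)
        ≡⟨ ∑-*ˡ (suc n) (sign j * A fzero j) (innerTerm j) ⟨
      ∑ (suc n) (λ k → sign j * A fzero j * innerTerm j k)
        ≡⟨ ∑-cong (suc n) (sym ∘ pairTerm-punchIn j) ⟩
      ∑ (suc n) (pairTerm j ∘ punchIn j)
        ≡⟨ ℤP.+-identityˡ _ ⟨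
      0ℤ + ∑ (suc n) (pairTerm j ∘ punchIn j)
        ≡⟨ cong (_+ ∑ (suc n) (pairTerm j ∘ punchIn j)) (pairTerm-diag j) ⟨
      pairTerm j j + ∑ (suc n) (pairTerm j ∘ punchIn j)
        ≡⟨ ∑-remove (suc n) (pairTerm j) j ⟨
      ∑ (suc (suc n)) (pairTerm j) ∎

rowCases : ∀ {n} {P : Fin n → Set} (i j : Fin n) → P i → P j → (∀ k → k ≢ i → k ≢ j → P k) → ∀ k → P k
rowCases i j Pᵢ Pⱼ Pₖ k with k FinP.≟ i | k FinP.≟ j
... | yes refl | _        = Pᵢ
... | no _     | yes refl = Pⱼ
... | no k≢i   | no k≢j   = Pₖ k k≢i k≢j

record RowSwap {n} (i j : Fin n) (A B : Matrix n) : Set where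
  field
    distinct  : i ≢ j
    swappedˡ  : B i ≗ A j
    swappedʳ  : B j ≗ A i
    unchanged : ∀ k → k ≢ i → k ≢ j → B k ≗ A k

rowSwap-unique : ∀ {n} {i j : Fin n} {A B C : Matrix n} → RowSwap i j A B → RowSwap i j A C → ∀ k → B k ≗ C k
rowSwap-unique {i = i} {j} s s′ = rowCases i j
  (λ t → trans (RowSwap.swappedˡ s t) (sym (RowSwap.swappedˡ s′ t)))
  (λ t → trans (RowSwap.swappedʳ s t) (sym (RowSwap.swappedʳ s′ t)))
  (λ k k≢i k≢j t → trans (RowSwap.unchanged s k k≢i k≢j t) (sym (RowSwap.unchanged s′ k k≢i k≢j t)))

setRows : ∀ {n} → Matrix n → Fin n → Row n → Fin n → Row n → Matrix n
setRows A i u j v = updateAt (updateAt A i (const u)) j (const v)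

module _ {n} (A : Matrix n) {i j : Fin n} (i≢j : i ≢ j) where

  setRows-ˡ : ∀ u v → setRows A i u j v i ≡ u
  setRows-ˡ u v = trans (updateAt-minimal i j _ i≢j) (updateAt-updates i A)

  setRows-ʳ : ∀ u v → setRows A i u j v j ≡ v
  setRows-ʳ u v = updateAt-updates j _

  setRows-other : ∀ u v k → k ≢ i → k ≢ j → setRows A i u j v k ≡ A k
  setRows-other u v k k≢i k≢j = trans (updateAt-minimal k j _ k≢j) (updateAt-minimal k i A k≢i)

  setRows-agreeOffˡ : ∀ u u′ v → AgreeOff i (setRows A i u j v) (setRows A i u′ j v)
  setRows-agreeOffˡ u u′ v = rowCases {P = λ k → k ≢ i → setRows A i u j v k ≗ setRows A i u′ j v k} i j
    (λ i≢i → ⊥-elim (i≢i refl))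
    (λ _ → cong-app (trans (setRows-ʳ u v) (sym (setRows-ʳ u′ v))))
    (λ k k≢i k≢j _ → cong-app (trans (setRows-other u v k k≢i k≢j) (sym (setRows-other u′ v k k≢i k≢j))))

  setRows-agreeOffʳ : ∀ u v v′ → AgreeOff j (setRows A i u j v) (setRows A i u j v′)
  setRows-agreeOffʳ u v v′ k k≢j =
    cong-app (trans (updateAt-minimal k j _ k≢j) (sym (updateAt-minimal k j _ k≢j)))

swapRows : ∀ {n} → Matrix n → Fin n → Fin n → Matrix n
swapRows A i j = setRows A i (A j) j (A i)

swapRows-rowSwap : ∀ {n} (A : Matrix n) {i j : Fin n} → i ≢ j → RowSwap i j A (swapRows A i j)
swapRows-rowSwap A {i} {j} i≢j = record
  { distinct  = i≢j
  ; swappedˡ  = cong-app (setRows-ˡ A i≢j (A j) (A i))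
  ; swappedʳ  = cong-app (setRows-ʳ A i≢j (A j) (A i))
  ; unchanged = λ k k≢i k≢j → cong-app (setRows-other A i≢j (A j) (A i) k k≢i k≢j)
  }

Alternating : ℕ → Set
Alternating n = ∀ (A : Matrix n) {i j} → i ≢ j → A i ≗ A j → det n A ≡ 0ℤ

SwapNegates : ℕ → Set
SwapNegates n = ∀ {A B : Matrix n} {i j} → RowSwap i j A B → det n B ≡ - det n A

-- Expand det (rows i, j := a + b) by additivity in both rows: the two repeated-row terms vanish.
alternating⇒swapNegates : ∀ {n} → Alternating n → SwapNegates n
alternating⇒swapNegates {n} alt {A} {B} {i} {j} swap = inverseʳ-unique (det n A) (det n B) (begin
  det n A + det n B
    ≡⟨ cong₂ _+_ (det-cong n unswapped) (det-cong n swapped) ⟩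
  det n (X a b) + det n (X b a)
    ≡⟨ pad (det n (X a b)) (det n (X b a)) ⟩
  (0ℤ + det n (X a b)) + (det n (X b a) + 0ℤ)
    ≡⟨ cong₂ (λ x y → (x + det n (X a b)) + (det n (X b a) + y)) (vanish a) (vanish b) ⟨
  (det n (X a a) + det n (X a b)) + (det n (X b a) + det n (X b b))
    ≡⟨ cong₂ _+_ (additiveʳ a a b) (additiveʳ b a b) ⟨
  det n (X a s) + det n (X b s)
    ≡⟨ additiveˡ a b s ⟨
  det n (X s s)
    ≡⟨ vanish s ⟩
  0ℤ ∎)
  where
  open ≡-Reasoning
  i≢j : i ≢ j
  i≢j = RowSwap.distinct swap
  X : Row n → Row n → Matrix n
  X u v = setRows A i u j v
  a b s : Row n
  a = A i
  b = A j
  s t = a t + b t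
  pad : ∀ x y → x + y ≡ (0ℤ + x) + (y + 0ℤ)
  pad = solve-∀
  vanish : ∀ u → det n (X u u) ≡ 0ℤ
  vanish u = alt (X u u) i≢j (cong-app (trans (setRows-ˡ A i≢j u u) (sym (setRows-ʳ A i≢j u u))))
  additiveˡ : ∀ u u′ v → det n (X (λ t → u t + u′ t) v) ≡ det n (X u v) + det n (X u′ v)
  additiveˡ u u′ v = det-additive n _ _ _ i
    (λ t → trans (cong-app (setRows-ˡ A i≢j _ v) t)
                 (sym (cong₂ _+_ (cong-app (setRows-ˡ A i≢j u v) t) (cong-app (setRows-ˡ A i≢j u′ v) t))))
    (setRows-agreeOffˡ A i≢j _ u v) (setRows-agreeOffˡ A i≢j _ u′ v)
  additiveʳ : ∀ u v v′ → det n (X u (λ t → v t + v′ t)) ≡ det n (X u v) + det n (X u v′)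
  additiveʳ u v v′ = det-additive n _ _ _ j
    (λ t → trans (cong-app (setRows-ʳ A i≢j u _) t)
                 (sym (cong₂ _+_ (cong-app (setRows-ʳ A i≢j u v) t) (cong-app (setRows-ʳ A i≢j u v′) t))))
    (setRows-agreeOffʳ A i≢j u _ v) (setRows-agreeOffʳ A i≢j u _ v′)
  unswapped : ∀ k → A k ≗ X a b k
  unswapped = rowCases i j
    (cong-app (sym (setRows-ˡ A i≢j a b)))
    (cong-app (sym (setRows-ʳ A i≢j a b)))
    (λ k k≢i k≢j → cong-app (sym (setRows-other A i≢j a b k k≢i k≢j)))
  swapped : ∀ k → B k ≗ X b a k
  swapped = rowSwap-unique swap (swapRows-rowSwap A i≢j)

minor-rowSwap : ∀ {n} {i j : Fin n} {A B : Matrix (suc n)} →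
                RowSwap (fsuc i) (fsuc j) A B → ∀ c → RowSwap i j (minor A c) (minor B c)
minor-rowSwap swap c = record
  { distinct  = RowSwap.distinct swap ∘ cong fsuc
  ; swappedˡ  = RowSwap.swappedˡ swap ∘ punchIn c
  ; swappedʳ  = RowSwap.swappedʳ swap ∘ punchIn c
  ; unchanged = λ k k≢i k≢j → RowSwap.unchanged swap (fsuc k) (k≢i ∘ FinP.suc-injective) (k≢j ∘ FinP.suc-injective) ∘ punchIn c
  }

det-swapLower : ∀ {n} → SwapNegates n → ∀ {A B : Matrix (suc n)} {i j} →
                RowSwap (fsuc i) (fsuc j) A B → det (suc n) B ≡ - det (suc n) A
det-swapLower {n} swapₙ {A} {B} swap = trans (∑-cong (suc n) negTerm) (∑-neg (suc n) (expansionTerm A))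
  where
  negTerm : ∀ c → expansionTerm B c ≡ - expansionTerm A c
  negTerm c = trans (cong₂ (λ x d → sign c * x * d) (RowSwap.unchanged swap fzero (λ ()) (λ ()) c)
                                                      (swapₙ (minor-rowSwap swap c)))
                    (sym (ℤP.neg-distribʳ-* (sign c * A fzero c) _))

neg≡0⇒≡0 : ∀ {x} → - x ≡ 0ℤ → x ≡ 0ℤ
neg≡0⇒≡0 {x} -x≡0 = trans (sym (ℤP.neg-involutive x)) (cong -_ -x≡0)

det-repeatedFirstRow : ∀ {n} → Alternating n → ∀ (A : Matrix (suc n)) j → A fzero ≗ A (fsuc j) → det (suc n) A ≡ 0ℤ
det-repeatedFirstRow {suc n} altₙ A fzero     A₀≗A₁ = EqualFirstRows.det-equalFirstRows A A₀≗A₁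
-- Swapping rows 1 and j + 1 moves the repeated row next to row 0.
det-repeatedFirstRow {suc n} altₙ A (fsuc j) A₀≗Aⱼ = neg≡0⇒≡0 (trans (sym (det-swapLower swapₙ swap)) swappedVanishes)
  where
  swapₙ : SwapNegates (suc n)
  swapₙ = alternating⇒swapNegates altₙ
  A′ : Matrix (suc (suc n))
  A′ = swapRows A (fsuc fzero) (fsuc (fsuc j))
  swap : RowSwap (fsuc fzero) (fsuc (fsuc j)) A A′
  swap = swapRows-rowSwap A (λ ())
  swappedVanishes : det (suc (suc n)) A′ ≡ 0ℤ
  swappedVanishes = EqualFirstRows.det-equalFirstRows A′ λ t →
    trans (RowSwap.unchanged swap fzero (λ ()) (λ ()) t) (trans (A₀≗Aⱼ t) (sym (RowSwap.swappedˡ swap t)))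

det-alternating : ∀ n → Alternating n
det-alternating (suc n) A {fzero}  {fzero}  0≢0 _ = ⊥-elim (0≢0 refl)
det-alternating (suc n) A {fzero}  {fsuc j} _ A₀≗Aⱼ = det-repeatedFirstRow (det-alternating n) A j A₀≗Aⱼ
det-alternating (suc n) A {fsuc i} {fzero}  _ Aᵢ≗A₀ = det-repeatedFirstRow (det-alternating n) A i (sym ∘ Aᵢ≗A₀)
det-alternating (suc n) A {fsuc i} {fsuc j} i≢j Aᵢ≗Aⱼ = ∑-zero (suc n) λ c →
  trans (cong (sign c * A fzero c *_) (det-alternating n (minor A c) (i≢j ∘ cong fsuc) (Aᵢ≗Aⱼ ∘ punchIn c)))
        (ℤP.*-zeroʳ (sign c * A fzero c))

det-swap : ∀ n → SwapNegates n
det-swap n = alternating⇒swapNegates (det-alternating n)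

-- Rotating rows, summing rows, anti-triangular matrices

insertAt-≢ : ∀ {A : Set} {n} (xs : Fin n → A) {i k : Fin (suc n)} v (i≢k : i ≢ k) → insertAt xs i v k ≡ xs (punchOut i≢k)
insertAt-≢ xs {i} v i≢k = trans (cong (insertAt xs i v) (sym (FinP.punchIn-punchOut i≢k))) (insertAt-punchIn xs i v _)

map-insertAt : ∀ {A B : Set} {n} (f : A → B) (xs : Fin n → A) i v k → f (insertAt xs i v k) ≡ insertAt (f ∘ xs) i (f v) k
map-insertAt f xs fzero v fzero = refl
map-insertAt f xs fzero v (fsuc k) = refl
map-insertAt {n = suc n} f xs (fsuc i) v fzero = refl
map-insertAt {n = suc n} f xs (fsuc i) v (fsuc k) = map-insertAt f (tail xs) i v k

punchIn-fromℕ : ∀ {n} (k : Fin n) → punchIn (fromℕ n) k ≡ inject₁ k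
punchIn-fromℕ fzero    = refl
punchIn-fromℕ (fsuc k) = cong fsuc (punchIn-fromℕ k)

insertAt-inject₁ : ∀ {A : Set} {n} (xs : Fin n → A) v j → insertAt xs (fromℕ n) v (inject₁ j) ≡ xs j
insertAt-inject₁ {n = n} xs v j =
  trans (cong (insertAt xs (fromℕ n) v) (sym (punchIn-fromℕ j))) (insertAt-punchIn xs (fromℕ n) v j)

-1^suc-* : ∀ m y → -1ℤ ^ suc m * y ≡ - (-1ℤ ^ m * y)
-1^suc-* m y = trans (ℤP.*-assoc -1ℤ (-1ℤ ^ m) y) (ℤP.-1*i≡-i (-1ℤ ^ m * y))

-- Swap the first and last rows, then move the first row of each minor to its bottom.
det-rotate : ∀ m (x : Row (suc m)) (R : Fin m → Row (suc m)) →
             det (suc m) (insertAt R (fromℕ m) x) ≡ -1ℤ ^ m * det (suc m) (x Vector.∷ R)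
det-rotate zero x R = trans (det-cong 1 single) (sym (ℤP.*-identityˡ _))
  where
  single : ∀ i → insertAt R fzero x i ≗ (x Vector.∷ R) i
  single fzero t = refl
det-rotate (suc m) x R = begin
  det (suc (suc m)) B                     ≡⟨ ℤP.neg-involutive _ ⟨
  - - det (suc (suc m)) B                 ≡⟨ cong -_ (det-swap (suc (suc m)) swap) ⟨
  - det (suc (suc m)) C                   ≡⟨ cong -_ expandC ⟩
  - (-1ℤ ^ m * det (suc (suc m)) (x Vector.∷ R)) ≡⟨ -1^suc-* m _ ⟨
  -1ℤ ^ suc m * det (suc (suc m)) (x Vector.∷ R) ∎
  where
  open ≡-Reasoning
  B C : Matrix (suc (suc m))
  B = insertAt R (fromℕ (suc m)) x
  C = x Vector.∷ insertAt (tail R) (fromℕ m) (R fzero)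
  swap : RowSwap fzero (fromℕ (suc m)) B C
  swap = record
    { distinct  = λ ()
    ; swappedˡ  = cong-app (sym (insertAt-lookup R (fromℕ (suc m)) x))
    ; swappedʳ  = cong-app (insertAt-lookup (tail R) (fromℕ m) (R fzero))
    ; unchanged = λ { fzero 0≢0 _ → ⊥-elim (0≢0 refl)
                    ; (fsuc k) _ k≢last t → cong-app (trans (insertAt-≢ (tail R) (R fzero) (k≢last ∘ cong fsuc ∘ sym))
                                                            (sym (insertAt-≢ (tail R) x (k≢last ∘ cong fsuc ∘ sym)))) t }
    }
  minorC : ∀ j → det (suc m) (minor C j) ≡ -1ℤ ^ m * det (suc m) (minor (x Vector.∷ R) j)
  minorC j = begin
    det (suc m) (minor C j)
      ≡⟨ det-cong (suc m) (λ i t → cong-app (map-insertAt (_∘ punchIn j) (tail R) (fromℕ m) (R fzero) i) t) ⟩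
    det (suc m) (insertAt (λ i → R (fsuc i) ∘ punchIn j) (fromℕ m) (R fzero ∘ punchIn j))
      ≡⟨ det-rotate m (R fzero ∘ punchIn j) (λ i → R (fsuc i) ∘ punchIn j) ⟩
    -1ℤ ^ m * det (suc m) ((R fzero ∘ punchIn j) Vector.∷ (λ i → R (fsuc i) ∘ punchIn j))
      ≡⟨ cong (-1ℤ ^ m *_) (det-cong (suc m) minor∷) ⟩
    -1ℤ ^ m * det (suc m) (minor (x Vector.∷ R) j) ∎
    where
    minor∷ : ∀ i → ((R fzero ∘ punchIn j) Vector.∷ (λ i → R (fsuc i) ∘ punchIn j)) i ≗ minor (x Vector.∷ R) j i
    minor∷ fzero    t = refl
    minor∷ (fsuc i) t = refl
  expandC : det (suc (suc m)) C ≡ -1ℤ ^ m * det (suc (suc m)) (x Vector.∷ R)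
  expandC = begin
    ∑ (suc (suc m)) (expansionTerm C)
      ≡⟨ ∑-cong (suc (suc m)) (λ j → trans (cong (sign j * x j *_) (minorC j))
                                           (commute (sign j * x j) (-1ℤ ^ m) _)) ⟩
    ∑ (suc (suc m)) (λ j → -1ℤ ^ m * expansionTerm (x Vector.∷ R) j)
      ≡⟨ ∑-*ˡ (suc (suc m)) (-1ℤ ^ m) (expansionTerm (x Vector.∷ R)) ⟩
    -1ℤ ^ m * det (suc (suc m)) (x Vector.∷ R) ∎
    where
    commute : ∀ a b c → a * (b * c) ≡ b * (a * c)
    commute = solve-∀

det-zeroRow : ∀ n (A : Matrix n) k → (∀ t → A k t ≡ 0ℤ) → det n A ≡ 0ℤ
det-zeroRow n A k Aₖ≡0 = identityʳ-unique (det n A) (det n A) (sym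
  (det-additive n A A A k (λ t → trans (sym (ℤP.+-identityʳ (A k t))) (cong (_+_ (A k t)) (sym (Aₖ≡0 t))))
                (λ _ _ _ → refl) (λ _ _ _ → refl)))

det-rowSum : ∀ n (A : Matrix n) k (w : Row n) L (v : Fin L → Row n) → (∀ t → w t ≡ ∑ L (λ l → v l t)) →
             det n (updateAt A k (const w)) ≡ ∑ L (λ l → det n (updateAt A k (const (v l))))
det-rowSum n A k w zero    v w≡0 =
  det-zeroRow n (updateAt A k (const w)) k (λ t → trans (cong-app (updateAt-updates k A) t) (w≡0 t))
det-rowSum n A k w (suc L) v w≡∑ = begin
  det n (set w)
    ≡⟨ det-additive n _ _ _ k split unchanged unchanged ⟩
  det n (set (v fzero)) + det n (set rest)
    ≡⟨ cong (_+_ (det n (set (v fzero)))) (det-rowSum n A k rest L (v ∘ fsuc) (λ _ → refl)) ⟩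
  ∑ (suc L) (λ l → det n (set (v l))) ∎
  where
  open ≡-Reasoning
  set : Row n → Matrix n
  set u = updateAt A k (const u)
  rest : Row n
  rest t = ∑ L (λ l → v (fsuc l) t)
  updated : ∀ u t → set u k t ≡ u t
  updated u = cong-app (updateAt-updates k A)
  split : ∀ t → set w k t ≡ set (v fzero) k t + set rest k t
  split t = trans (updated w t) (trans (w≡∑ t) (sym (cong₂ _+_ (updated (v fzero) t) (updated rest t))))
  unchanged : ∀ {u u′} → AgreeOff k (set u) (set u′)
  unchanged i i≢k = cong-app (trans (updateAt-minimal i k A i≢k) (sym (updateAt-minimal i k A i≢k)))

-1^m*-1^[m/2]≡-1^[1+m]/2 : ∀ m → -1ℤ ^ m * -1ℤ ^ (m / 2) ≡ -1ℤ ^ (suc m / 2)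
-1^m*-1^[m/2]≡-1^[1+m]/2 zero = refl
-1^m*-1^[m/2]≡-1^[1+m]/2 (suc zero) = refl
-1^m*-1^[m/2]≡-1^[1+m]/2 (suc (suc m)) = begin
  -1ℤ ^ suc (suc m) * -1ℤ ^ (suc (suc m) / 2) ≡⟨ cong (λ e → -1ℤ ^ suc (suc m) * -1ℤ ^ e) (half-suc-suc m) ⟩
  -1ℤ ^ suc (suc m) * -1ℤ ^ suc (m / 2)       ≡⟨ regroup (-1ℤ ^ m) (-1ℤ ^ (m / 2)) ⟩
  -1ℤ * (-1ℤ ^ m * -1ℤ ^ (m / 2))             ≡⟨ cong (-1ℤ *_) (-1^m*-1^[m/2]≡-1^[1+m]/2 m) ⟩
  -1ℤ ^ suc (suc m / 2)                       ≡⟨ cong (-1ℤ ^_) (half-suc-suc (suc m)) ⟨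
  -1ℤ ^ (suc (suc (suc m)) / 2)               ∎
  where
  open ≡-Reasoning
  half-suc-suc : ∀ k → suc (suc k) / 2 ≡ suc (k / 2)
  half-suc-suc k = m/n≡1+[m∸n]/n {suc (suc k)} {2} (ℕ.s≤s (ℕ.s≤s ℕ.z≤n))
  regroup : ∀ x y → (-1ℤ * (-1ℤ * x)) * (-1ℤ * y) ≡ -1ℤ * (x * y)
  regroup = solve-∀

det-antiTriangular : ∀ n (A : Matrix n) →
                     (∀ i k → suc (toℕ i ℕ.+ toℕ k) ℕ.< n → A i k ≡ 0ℤ) →
                     (∀ i k → suc (toℕ i ℕ.+ toℕ k) ≡ n → A i k ≡ 1ℤ) →
                     det n A ≡ -1ℤ ^ (n / 2)
det-antiTriangular zero    A above anti = refl
det-antiTriangular (suc n) A above anti = begin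
  ∑ (suc n) (expansionTerm A)
    ≡⟨ ∑-single n (expansionTerm A) (fromℕ n) offAnti ⟩
  sign (fromℕ n) * A fzero (fromℕ n) * det n (minor A (fromℕ n))
    ≡⟨ cong₂ (λ e a → -1ℤ ^ e * a * det n (minor A (fromℕ n)))
             (FinP.toℕ-fromℕ n) (anti fzero (fromℕ n) (cong suc (FinP.toℕ-fromℕ n))) ⟩
  -1ℤ ^ n * 1ℤ * det n (minor A (fromℕ n))
    ≡⟨ cong₂ _*_ (ℤP.*-identityʳ (-1ℤ ^ n)) (det-antiTriangular n (minor A (fromℕ n)) minorAbove minorAnti) ⟩
  -1ℤ ^ n * -1ℤ ^ (n / 2)
    ≡⟨ -1^m*-1^[m/2]≡-1^[1+m]/2 n ⟩
  -1ℤ ^ (suc n / 2) ∎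
  where
  open ≡-Reasoning
  offAnti : ∀ k → expansionTerm A (punchIn (fromℕ n) k) ≡ 0ℤ
  offAnti k rewrite punchIn-fromℕ k | above fzero (inject₁ k) (ℕ.s≤s (FinP.inject₁ℕ< k)) =
    cong (_* det n (minor A (inject₁ k))) (ℤP.*-zeroʳ (sign (inject₁ k)))
  minorAbove : ∀ i k → suc (toℕ i ℕ.+ toℕ k) ℕ.< n → minor A (fromℕ n) i k ≡ 0ℤ
  minorAbove i k lt rewrite punchIn-fromℕ k =
    above (fsuc i) (inject₁ k) (ℕ.s≤s (subst (λ c → suc (toℕ i ℕ.+ c) ℕ.< n) (sym (FinP.toℕ-inject₁ k)) lt))
  minorAnti : ∀ i k → suc (toℕ i ℕ.+ toℕ k) ≡ n → minor A (fromℕ n) i k ≡ 1ℤ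
  minorAnti i k eq rewrite punchIn-fromℕ k =
    anti (fsuc i) (inject₁ k) (cong suc (subst (λ c → suc (toℕ i ℕ.+ c) ≡ n) (sym (FinP.toℕ-inject₁ k)) eq))

-- Hankel determinants of a linear recurrence

offsets : ∀ m → ℕ → Fin (suc m) → ℕ
offsets m P = insertAt toℕ (fromℕ m) P

module RecurrentHankel
  (m : ℕ) (e : ℕ → ℤ)
  (e-rec : ∀ t → e (t ℕ.+ suc m) ≡ ∑ (suc m) (λ i → e (t ℕ.+ toℕ i)))
  (e-init : ∀ t → t ℕ.< m → e t ≡ 0ℤ) (e-m : e m ≡ 1ℤ)
  (P : ℕ) where

  col : Fin (suc m) → ℕ
  col = offsets m P

  row : ℕ → Row (suc m)
  row s b = e (s ℕ.+ col b)

  hankel : ℕ → Matrix (suc m)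
  hankel u a = row (u ℕ.+ toℕ a)

  withLastRow : ℕ → ℕ → Matrix (suc m)
  withLastRow u s = updateAt (hankel u) (fromℕ m) (const (row s))

  withLastRow-fromℕ : ∀ u s → withLastRow u s (fromℕ m) ≡ row s
  withLastRow-fromℕ u s = updateAt-updates (fromℕ m) (hankel u)

  withLastRow-inject₁ : ∀ u s a → withLastRow u s (inject₁ a) ≡ row (u ℕ.+ toℕ a)
  withLastRow-inject₁ u s a = trans (updateAt-minimal (inject₁ a) (fromℕ m) (hankel u) (FinP.fromℕ≢inject₁ ∘ sym))
                                    (cong (λ k → row (u ℕ.+ k)) (FinP.toℕ-inject₁ a))

  withLastRow-hankel : ∀ u a → withLastRow u (u ℕ.+ m) a ≗ hankel u a
  withLastRow-hankel u a = cong-app (updateAt-id-local (fromℕ m) (hankel u) (cong (λ k → row (u ℕ.+ k)) (sym (FinP.toℕ-fromℕ m))) a)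

  row-rec : ∀ s b → row (s ℕ.+ suc m) b ≡ ∑ (suc m) (λ i → row (s ℕ.+ toℕ i) b)
  row-rec s b = begin
    e (s ℕ.+ suc m ℕ.+ col b)                      ≡⟨ cong e (swap-last (suc m)) ⟩
    e (s ℕ.+ col b ℕ.+ suc m)                      ≡⟨ e-rec (s ℕ.+ col b) ⟩
    ∑ (suc m) (λ i → e (s ℕ.+ col b ℕ.+ toℕ i))    ≡⟨ ∑-cong (suc m) (λ i → cong e (swap-last (toℕ i))) ⟨
    ∑ (suc m) (λ i → e (s ℕ.+ toℕ i ℕ.+ col b))    ∎
    where
    open ≡-Reasoning
    swap-last : ∀ k → s ℕ.+ k ℕ.+ col b ≡ s ℕ.+ col b ℕ.+ k
    swap-last k = trans (ℕP.+-assoc s k (col b)) (trans (cong (s ℕ.+_) (ℕP.+-comm k (col b))) (sym (ℕP.+-assoc s (col b) k)))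

  det-withLastRow-repeated : ∀ u (a : Fin m) → det (suc m) (withLastRow u (u ℕ.+ toℕ a)) ≡ 0ℤ
  det-withLastRow-repeated u a = det-alternating (suc m) (withLastRow u (u ℕ.+ toℕ a)) FinP.fromℕ≢inject₁ λ t →
    cong-app (trans (withLastRow-fromℕ u _) (sym (withLastRow-inject₁ u _ a))) t

  det-withLastRow-rec : ∀ u t → det (suc m) (withLastRow u (u ℕ.+ (t ℕ.+ suc m)))
                                ≡ ∑ (suc m) (λ i → det (suc m) (withLastRow u (u ℕ.+ (t ℕ.+ toℕ i))))
  det-withLastRow-rec u t = det-rowSum (suc m) (hankel u) (fromℕ m) _ (suc m) (λ i → row (u ℕ.+ (t ℕ.+ toℕ i))) λ b →
    trans (cong (λ s → row s b) (sym (ℕP.+-assoc u t (suc m))))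
          (trans (row-rec (u ℕ.+ t) b) (∑-cong (suc m) λ i → cong (λ s → row s b) (ℕP.+-assoc u t (toℕ i))))

  det-withLastRow : ∀ u t → det (suc m) (withLastRow u (u ℕ.+ t)) ≡ e t * det (suc m) (hankel u)
  det-withLastRow u = <-rec _ go
    where
    H : ℤ
    H = det (suc m) (hankel u)
    D : ℕ → ℤ
    D t = det (suc m) (withLastRow u (u ℕ.+ t))
    go : ∀ t → (∀ {s} → s ℕ.< t → D s ≡ e s * H) → D t ≡ e t * H
    go t ih with ℕP.<-cmp t m
    ... | tri< t<m _ _ = begin
      D t                     ≡⟨ cong D (FinP.toℕ-fromℕ< t<m) ⟨
      D (toℕ (fromℕ< t<m))    ≡⟨ det-withLastRow-repeated u (fromℕ< t<m) ⟩
      0ℤ                      ≡⟨ cong (_* H) (e-init t t<m) ⟨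
      e t * H                 ∎
      where open ≡-Reasoning
    ... | tri≈ _ refl _ = begin
      D m        ≡⟨ det-cong (suc m) (withLastRow-hankel u) ⟩
      H          ≡⟨ ℤP.*-identityˡ H ⟨
      1ℤ * H     ≡⟨ cong (_* H) e-m ⟨
      e m * H    ∎
      where open ≡-Reasoning
    ... | tri> _ _ m<t = subst (λ s → D s ≡ e s * H) (ℕP.m∸n+n≡m m<t) (begin
      D (t′ ℕ.+ suc m)                            ≡⟨ det-withLastRow-rec u t′ ⟩
      ∑ (suc m) (λ i → D (t′ ℕ.+ toℕ i))          ≡⟨ ∑-cong (suc m) (λ i → ih (below i)) ⟩
      ∑ (suc m) (λ i → e (t′ ℕ.+ toℕ i) * H)      ≡⟨ ∑-*ʳ (suc m) H (λ i → e (t′ ℕ.+ toℕ i)) ⟩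
      ∑ (suc m) (λ i → e (t′ ℕ.+ toℕ i)) * H      ≡⟨ cong (_* H) (e-rec t′) ⟨
      e (t′ ℕ.+ suc m) * H                        ∎)
      where
      open ≡-Reasoning
      t′ : ℕ
      t′ = t ℕ.∸ suc m
      below : ∀ (i : Fin (suc m)) → t′ ℕ.+ toℕ i ℕ.< t
      below i = subst (t′ ℕ.+ toℕ i ℕ.<_) (ℕP.m∸n+n≡m m<t) (ℕP.+-monoʳ-< t′ (FinP.toℕ<n i))

  det-hankel-suc : ∀ u → det (suc m) (hankel (suc u)) ≡ -1ℤ ^ m * det (suc m) (hankel u)
  det-hankel-suc u = begin
    det (suc m) (hankel (suc u))
      ≡⟨ det-cong (suc m) (withLastRow-hankel (suc u)) ⟨
    det (suc m) (withLastRow (suc u) (suc u ℕ.+ m))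
      ≡⟨ det-rowSum (suc m) (hankel (suc u)) (fromℕ m) _ (suc m) (λ i → row (u ℕ.+ toℕ i)) lastRow-rec ⟩
    ∑ (suc m) (λ i → det (suc m) (withLastRow (suc u) (u ℕ.+ toℕ i)))
      ≡⟨ ∑-single m (λ i → det (suc m) (withLastRow (suc u) (u ℕ.+ toℕ i))) fzero lastRow-repeated ⟩
    det (suc m) (withLastRow (suc u) (u ℕ.+ 0))
      ≡⟨ det-cong (suc m) rotated ⟩
    det (suc m) (insertAt R (fromℕ m) (row u))
      ≡⟨ det-rotate m (row u) R ⟩
    -1ℤ ^ m * det (suc m) (row u Vector.∷ R)
      ≡⟨ cong (-1ℤ ^ m *_) (det-cong (suc m) unrotated) ⟩
    -1ℤ ^ m * det (suc m) (hankel u) ∎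
    where
    open ≡-Reasoning
    R : Fin m → Row (suc m)
    R a = row (suc u ℕ.+ toℕ a)
    lastRow-rec : ∀ b → row (suc u ℕ.+ m) b ≡ ∑ (suc m) (λ i → row (u ℕ.+ toℕ i) b)
    lastRow-rec b = trans (cong (λ s → row s b) (sym (ℕP.+-suc u m))) (row-rec u b)
    lastRow-repeated : ∀ k → det (suc m) (withLastRow (suc u) (u ℕ.+ suc (toℕ k))) ≡ 0ℤ
    lastRow-repeated k = trans (cong (det (suc m) ∘ withLastRow (suc u)) (ℕP.+-suc u (toℕ k)))
                               (det-withLastRow-repeated (suc u) k)
    rotated : ∀ a → withLastRow (suc u) (u ℕ.+ 0) a ≗ insertAt R (fromℕ m) (row u) a
    rotated a with view a
    ... | ‵fromℕ     = cong-app (trans (withLastRow-fromℕ (suc u) _)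
                         (trans (cong row (ℕP.+-identityʳ u)) (sym (insertAt-lookup R (fromℕ m) (row u)))))
    ... | ‵inject₁ b = cong-app (trans (withLastRow-inject₁ (suc u) _ b) (sym (insertAt-inject₁ R (row u) b)))
    unrotated : ∀ a → (row u Vector.∷ R) a ≗ hankel u a
    unrotated fzero    t = cong (λ s → row s t) (sym (ℕP.+-identityʳ u))
    unrotated (fsuc a) t = cong (λ s → row s t) (sym (ℕP.+-suc u (toℕ a)))

  det-hankel-zero : det (suc m) (hankel 0) ≡ -1ℤ ^ m * e P * -1ℤ ^ (m / 2)
  det-hankel-zero = begin
    ∑ (suc m) (expansionTerm (hankel 0))
      ≡⟨ ∑-single m (expansionTerm (hankel 0)) (fromℕ m) firstRowZero ⟩
    sign (fromℕ m) * e (col (fromℕ m)) * det m (minor (hankel 0) (fromℕ m))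
      ≡⟨ cong₂ (λ k c → -1ℤ ^ k * e c * det m (minor (hankel 0) (fromℕ m)))
               (FinP.toℕ-fromℕ m) (insertAt-lookup toℕ (fromℕ m) P) ⟩
    -1ℤ ^ m * e P * det m (minor (hankel 0) (fromℕ m))
      ≡⟨ cong (-1ℤ ^ m * e P *_) (det-antiTriangular m _ minorAbove minorAnti) ⟩
    -1ℤ ^ m * e P * -1ℤ ^ (m / 2) ∎
    where
    open ≡-Reasoning
    firstRowZero : ∀ k → expansionTerm (hankel 0) (punchIn (fromℕ m) k) ≡ 0ℤ
    firstRowZero k rewrite punchIn-fromℕ k | insertAt-inject₁ toℕ P k | e-init (toℕ k) (FinP.toℕ<n k) =
      cong (_* det m (minor (hankel 0) (inject₁ k))) (ℤP.*-zeroʳ (sign (inject₁ k)))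
    minorEntry : ∀ i k → minor (hankel 0) (fromℕ m) i k ≡ e (suc (toℕ i ℕ.+ toℕ k))
    minorEntry i k rewrite punchIn-fromℕ k | insertAt-inject₁ toℕ P k = refl
    minorAbove : ∀ i k → suc (toℕ i ℕ.+ toℕ k) ℕ.< m → minor (hankel 0) (fromℕ m) i k ≡ 0ℤ
    minorAbove i k lt = trans (minorEntry i k) (e-init _ lt)
    minorAnti : ∀ i k → suc (toℕ i ℕ.+ toℕ k) ≡ m → minor (hankel 0) (fromℕ m) i k ≡ 1ℤ
    minorAnti i k eq = trans (minorEntry i k) (trans (cong e eq) e-m)

  det-hankel : ∀ u → det (suc m) (hankel u) ≡ -1ℤ ^ (m ℕ.* u) * det (suc m) (hankel 0)
  det-hankel zero = begin
    det (suc m) (hankel 0)                     ≡⟨ ℤP.*-identityˡ _ ⟨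
    1ℤ * det (suc m) (hankel 0)                ≡⟨ cong (λ k → -1ℤ ^ k * det (suc m) (hankel 0)) (ℕP.*-zeroʳ m) ⟨
    -1ℤ ^ (m ℕ.* 0) * det (suc m) (hankel 0)   ∎
    where open ≡-Reasoning
  det-hankel (suc u) = begin
    det (suc m) (hankel (suc u))                  ≡⟨ det-hankel-suc u ⟩
    -1ℤ ^ m * H u                                 ≡⟨ cong (-1ℤ ^ m *_) (det-hankel u) ⟩
    -1ℤ ^ m * (-1ℤ ^ (m ℕ.* u) * H 0)             ≡⟨ ℤP.*-assoc (-1ℤ ^ m) _ _ ⟨
    -1ℤ ^ m * -1ℤ ^ (m ℕ.* u) * H 0               ≡⟨ cong (_* H 0) (ℤP.^-distribˡ-+-* -1ℤ m (m ℕ.* u)) ⟨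
    -1ℤ ^ (m ℕ.+ m ℕ.* u) * H 0                   ≡⟨ cong (λ k → -1ℤ ^ k * H 0) (ℕP.*-suc m u) ⟨
    -1ℤ ^ (m ℕ.* suc u) * H 0                     ∎
    where
    open ≡-Reasoning
    H : ℕ → ℤ
    H v = det (suc m) (hankel v)

  withLastRow-offsets : ∀ u a b → withLastRow u (u ℕ.+ P) a b ≡ e (u ℕ.+ col a ℕ.+ col b)
  withLastRow-offsets u a b with view a
  ... | ‵fromℕ     = cong-app (trans (withLastRow-fromℕ u _)
                       (cong (λ c → row (u ℕ.+ c)) (sym (insertAt-lookup toℕ (fromℕ m) P)))) b
  ... | ‵inject₁ x = cong-app (trans (withLastRow-inject₁ u _ x)
                       (cong (λ c → row (u ℕ.+ c)) (sym (insertAt-inject₁ toℕ P x)))) b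

  det-offsetHankel : ∀ u → det (suc m) (λ a b → e (u ℕ.+ col a ℕ.+ col b)) ≡ -1ℤ ^ (m ℕ.* u ℕ.+ suc m / 2) * e P ^ 2
  det-offsetHankel u = begin
    det (suc m) (λ a b → e (u ℕ.+ col a ℕ.+ col b))
      ≡⟨ det-cong (suc m) (withLastRow-offsets u) ⟨
    det (suc m) (withLastRow u (u ℕ.+ P))
      ≡⟨ det-withLastRow u P ⟩
    e P * det (suc m) (hankel u)
      ≡⟨ cong (e P *_) (trans (det-hankel u) (cong (-1ℤ ^ (m ℕ.* u) *_) det-hankel-zero)) ⟩
    e P * (-1ℤ ^ (m ℕ.* u) * (-1ℤ ^ m * e P * -1ℤ ^ (m / 2)))
      ≡⟨ regroup (e P) (-1ℤ ^ (m ℕ.* u)) (-1ℤ ^ m) (-1ℤ ^ (m / 2)) ⟩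
    -1ℤ ^ (m ℕ.* u) * (-1ℤ ^ m * -1ℤ ^ (m / 2)) * e P ^ 2
      ≡⟨ cong (λ s → -1ℤ ^ (m ℕ.* u) * s * e P ^ 2) (-1^m*-1^[m/2]≡-1^[1+m]/2 m) ⟩
    -1ℤ ^ (m ℕ.* u) * -1ℤ ^ (suc m / 2) * e P ^ 2
      ≡⟨ cong (_* e P ^ 2) (ℤP.^-distribˡ-+-* -1ℤ (m ℕ.* u) (suc m / 2)) ⟨
    -1ℤ ^ (m ℕ.* u ℕ.+ suc m / 2) * e P ^ 2 ∎
    where
    open ≡-Reasoning
    regroup : ∀ x a b c → x * (a * (b * x * c)) ≡ a * (b * c) * (x * (x * 1ℤ))
    regroup = solve-∀

-- The shifted n-step Fibonacci sequence

-- fib n k = F^(n)_(k+1) and shiftedFib m t = F^(m+1)_(t+1−m).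
fib : ℕ → ℕ → ℕ
fib n k = headOr0 (fibWindow n k)

delay : ℕ → (ℕ → ℕ) → ℕ → ℕ
delay zero    f t       = f t
delay (suc j) f zero    = 0
delay (suc j) f (suc t) = delay j f t

delay-+ : ∀ j f k → delay j f (j ℕ.+ k) ≡ f k
delay-+ zero    f k = refl
delay-+ (suc j) f k = delay-+ j f k

delay-< : ∀ j f t → t ℕ.< j → delay j f t ≡ 0
delay-< (suc j) f zero    _          = refl
delay-< (suc j) f (suc t) (ℕ.s≤s lt) = delay-< j f t lt

shiftedFib : ℕ → ℕ → ℕ
shiftedFib m = delay m (fib (suc m))

shiftedFib-m : ∀ m → shiftedFib m m ≡ 1
shiftedFib-m m = trans (cong (shiftedFib m) (sym (ℕP.+-identityʳ m))) (delay-+ m (fib (suc m)) 0)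

take-applyDownFrom : ∀ {A : Set} (f : ℕ → A) c → take c (applyDownFrom f (suc c)) ≡ applyDownFrom (f ∘ suc) c
take-applyDownFrom f zero    = refl
take-applyDownFrom f (suc c) = cong (f (suc c) ∷_) (take-applyDownFrom f c)

applyDownFrom-cong : ∀ {A : Set} {f g : ℕ → A} c → f ≗ g → applyDownFrom f c ≡ applyDownFrom g c
applyDownFrom-cong zero    f≗g = refl
applyDownFrom-cong (suc c) f≗g = cong₂ _∷_ (f≗g c) (applyDownFrom-cong c f≗g)

fibWindow-initial : ∀ m c → c ≤ m → take c (replicate (suc c) 0) ≡ applyDownFrom (shiftedFib m) c
fibWindow-initial m zero    _   = refl
fibWindow-initial m (suc c) c<m =
  cong₂ _∷_ (sym (delay-< m _ c c<m)) (fibWindow-initial m c (ℕP.≤-trans (ℕP.n≤1+n c) c<m))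

fibWindow≡applyDownFrom : ∀ m k → fibWindow (suc m) k ≡ applyDownFrom (λ i → shiftedFib m (k ℕ.+ i)) (suc m)
fibWindow≡applyDownFrom m zero = cong₂ _∷_ (sym (shiftedFib-m m)) (fibWindow-initial m m ℕP.≤-refl)
fibWindow≡applyDownFrom m (suc k) = cong₂ _∷_ newest older
  where
  w : List ℕ
  w = fibWindow (suc m) k
  newest : sum w ≡ shiftedFib m (suc k ℕ.+ m)
  newest = sym (trans (cong (shiftedFib m) (ℕP.+-comm (suc k) m)) (delay-+ m (fib (suc m)) (suc k)))
  older : take m w ≡ applyDownFrom (λ i → shiftedFib m (suc k ℕ.+ i)) m
  older = begin
    take m w
      ≡⟨ cong (take m) (fibWindow≡applyDownFrom m k) ⟩
    take m (applyDownFrom (λ i → shiftedFib m (k ℕ.+ i)) (suc m))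
      ≡⟨ take-applyDownFrom _ m ⟩
    applyDownFrom (λ i → shiftedFib m (k ℕ.+ suc i)) m
      ≡⟨ applyDownFrom-cong m (λ i → cong (shiftedFib m) (ℕP.+-suc k i)) ⟩
    applyDownFrom (λ i → shiftedFib m (suc k ℕ.+ i)) m ∎
    where open ≡-Reasoning

sum-applyDownFrom : ∀ (f : ℕ → ℕ) c → + sum (applyDownFrom f c) ≡ ∑ c (λ i → + f (toℕ i))
sum-applyDownFrom f zero    = refl
sum-applyDownFrom f (suc c) = begin
  + (f c ℕ.+ sum (applyDownFrom f c))
    ≡⟨ ℤP.pos-+ (f c) _ ⟩
  + f c + + sum (applyDownFrom f c)
    ≡⟨ ℤP.+-comm (+ f c) (+ sum (applyDownFrom f c)) ⟩
  + sum (applyDownFrom f c) + + f c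
    ≡⟨ cong₂ _+_ (trans (sum-applyDownFrom f c) (∑-cong c λ i → cong (+_ ∘ f) (sym (FinP.toℕ-inject₁ i))))
                 (cong (+_ ∘ f) (sym (FinP.toℕ-fromℕ c))) ⟩
  ∑ c (λ i → + f (toℕ (inject₁ i))) + + f (toℕ (fromℕ c))
    ≡⟨ ∑-init-last c (λ i → + f (toℕ i)) ⟨
  ∑ (suc c) (λ i → + f (toℕ i)) ∎
  where open ≡-Reasoning

shiftedFib-rec : ∀ m t → + shiftedFib m (t ℕ.+ suc m) ≡ ∑ (suc m) (λ i → + shiftedFib m (t ℕ.+ toℕ i))
shiftedFib-rec m t = begin
  + shiftedFib m (t ℕ.+ suc m)          ≡⟨ cong (+_ ∘ shiftedFib m) (trans (ℕP.+-comm t (suc m)) (sym (ℕP.+-suc m t))) ⟩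
  + shiftedFib m (m ℕ.+ suc t)          ≡⟨ cong +_ (delay-+ m (fib (suc m)) (suc t)) ⟩
  + sum (fibWindow (suc m) t)           ≡⟨ cong (+_ ∘ sum) (fibWindow≡applyDownFrom m t) ⟩
  + sum (applyDownFrom (λ i → shiftedFib m (t ℕ.+ i)) (suc m)) ≡⟨ sum-applyDownFrom _ (suc m) ⟩
  ∑ (suc m) (λ i → + shiftedFib m (t ℕ.+ toℕ i)) ∎
  where open ≡-Reasoning

F≡shiftedFib : ∀ k {z} t → z ≡ + t - + k → F (suc (suc k)) z ≡ shiftedFib (suc k) t
F≡shiftedFib k t refl with t ℕP.≤? k
... | yes t≤k = trans (cong (F (suc (suc k))) (trans (ℤP.m-n≡m⊖n t k) (ℤP.⊖-≤ t≤k)))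
                      (trans (F-nonpositive (k ℕ.∸ t)) (sym (delay-< (suc k) _ t (ℕ.s≤s t≤k))))
  where
  F-nonpositive : ∀ x → F (suc (suc k)) (- + x) ≡ 0
  F-nonpositive zero    = refl
  F-nonpositive (suc x) = refl
... | no t≰k = begin
  F (suc (suc k)) (+ t - + k)                  ≡⟨ cong (λ s → F (suc (suc k)) (+ s - + k)) t≡1+k+d ⟨
  F (suc (suc k)) (+ (suc k ℕ.+ d) - + k)      ≡⟨ cong (F (suc (suc k))) (index d) ⟩
  fib (suc (suc k)) d                          ≡⟨ delay-+ (suc k) _ d ⟨
  shiftedFib (suc k) (suc k ℕ.+ d)             ≡⟨ cong (shiftedFib (suc k)) t≡1+k+d ⟩
  shiftedFib (suc k) t                         ∎
  where
  open ≡-Reasoning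
  d : ℕ
  d = t ℕ.∸ suc k
  t≡1+k+d : suc k ℕ.+ d ≡ t
  t≡1+k+d = ℕP.m+[n∸m]≡n (ℕP.≰⇒> t≰k)
  index : ∀ d → + (suc k ℕ.+ d) - + k ≡ + suc d
  index d rewrite ℤP.pos-+ (suc k) d | ℤP.pos-+ 1 k | ℤP.pos-+ 1 d = lemma (+ k) (+ d)
    where
    lemma : ∀ k d → + 1 + k + d - k ≡ + 1 + d
    lemma = solve-∀

-- The matrix of the theorem

toℕ-inject₁<ᵇ : ∀ {m} (x : Fin m) → (toℕ (inject₁ x) <ᵇ m) ≡ true
toℕ-inject₁<ᵇ fzero    = refl
toℕ-inject₁<ᵇ (fsuc x) = toℕ-inject₁<ᵇ x

toℕ-fromℕ<ᵇ : ∀ m → (toℕ (fromℕ m) <ᵇ m) ≡ false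
toℕ-fromℕ<ᵇ zero    = refl
toℕ-fromℕ<ᵇ (suc m) = toℕ-fromℕ<ᵇ m

innerIndex : ∀ k r i j → + r - + suc (suc k) + + suc i + + suc j ≡ + (r ℕ.+ i ℕ.+ j) - + k
innerIndex k r i j rewrite ℤP.pos-+ (r ℕ.+ i) j | ℤP.pos-+ r i | ℤP.pos-+ 2 k | ℤP.pos-+ 1 i | ℤP.pos-+ 1 j =
  lemma (+ r) (+ i) (+ j) (+ k)
  where
  lemma : ∀ r i j k → r - (+ 2 + k) + (+ 1 + i) + (+ 1 + j) ≡ r + i + j - k
  lemma = solve-∀

edgeIndex : ∀ k r p i → + p + + r + + suc i - + 1 ≡ + (r ℕ.+ i ℕ.+ (p ℕ.+ k)) - + k
edgeIndex k r p i rewrite ℤP.pos-+ (r ℕ.+ i) (p ℕ.+ k) | ℤP.pos-+ r i | ℤP.pos-+ p k | ℤP.pos-+ 1 i =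
  lemma (+ r) (+ i) (+ p) (+ k)
  where
  lemma : ∀ r i p k → p + r + (+ 1 + i) - + 1 ≡ r + i + (p + k) - k
  lemma = solve-∀

edgeIndex′ : ∀ k r p j → + p + + r + + suc j - + 1 ≡ + (r ℕ.+ (p ℕ.+ k) ℕ.+ j) - + k
edgeIndex′ k r p j rewrite ℤP.pos-+ (r ℕ.+ (p ℕ.+ k)) j | ℤP.pos-+ r (p ℕ.+ k) | ℤP.pos-+ p k | ℤP.pos-+ 1 j =
  lemma (+ r) (+ j) (+ p) (+ k)
  where
  lemma : ∀ r j p k → p + r + (+ 1 + j) - + 1 ≡ r + (p + k) + j - k
  lemma = solve-∀

cornerIndex : ∀ k r p → + 2 * + p + + r + + suc (suc k) - + 2 ≡ + (r ℕ.+ (p ℕ.+ k) ℕ.+ (p ℕ.+ k)) - + k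
cornerIndex k r p rewrite ℤP.pos-+ (r ℕ.+ (p ℕ.+ k)) (p ℕ.+ k) | ℤP.pos-+ r (p ℕ.+ k) | ℤP.pos-+ p k | ℤP.pos-+ 2 k =
  lemma (+ r) (+ p) (+ k)
  where
  lemma : ∀ r p k → + 2 * p + r + (+ 2 + k) - + 2 ≡ r + (p + k) + (p + k) - k
  lemma = solve-∀

M-offsets : ∀ k r p a b → let c = offsets (suc k) (p ℕ.+ k) in
            M (suc (suc k)) r p a b ≡ + shiftedFib (suc k) (r ℕ.+ c a ℕ.+ c b)
M-offsets k r p a b with view a | view b
... | ‵inject₁ x | ‵inject₁ y
  rewrite toℕ-inject₁<ᵇ x | toℕ-inject₁<ᵇ y | insertAt-inject₁ toℕ (p ℕ.+ k) x | insertAt-inject₁ toℕ (p ℕ.+ k) y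
        | FinP.toℕ-inject₁ x | FinP.toℕ-inject₁ y = cong +_ (F≡shiftedFib k _ (innerIndex k r (toℕ x) (toℕ y)))
... | ‵inject₁ x | ‵fromℕ
  rewrite toℕ-inject₁<ᵇ x | toℕ-fromℕ<ᵇ (suc k)
        | insertAt-inject₁ toℕ (p ℕ.+ k) x | insertAt-lookup toℕ (fromℕ (suc k)) (p ℕ.+ k) | FinP.toℕ-inject₁ x = cong +_ (F≡shiftedFib k _ (edgeIndex k r p (toℕ x)))
... | ‵fromℕ | ‵inject₁ y
  rewrite toℕ-fromℕ<ᵇ (suc k) | toℕ-inject₁<ᵇ y
        | insertAt-lookup toℕ (fromℕ (suc k)) (p ℕ.+ k) | insertAt-inject₁ toℕ (p ℕ.+ k) y | FinP.toℕ-inject₁ y = cong +_ (F≡shiftedFib k _ (edgeIndex′ k r p (toℕ y)))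
... | ‵fromℕ | ‵fromℕ
  rewrite toℕ-fromℕ<ᵇ (suc k) | insertAt-lookup toℕ (fromℕ (suc k)) (p ℕ.+ k) = cong +_ (F≡shiftedFib k _ (cornerIndex k r p))

-- The identity holds for all r and p; only n ≥ 2 is used.
mainTheorem6 : (n r p : ℕ) → 2 ≤ n → 1 ≤ r → 1 ≤ p →
    det n (M n r p)
      ≡ (ℤ.- + 1) ℤ.^ ((n ℕ.∸ 1) ℕ.* r ℕ.+ n / 2) ℤ.* (+ F n (+ p)) ℤ.^ 2
mainTheorem6 0             r p ()                _ _
mainTheorem6 1             r p (ℕ.s≤s ())        _ _
mainTheorem6 (suc (suc k)) r p _ _ _ = begin
  det n (M n r p)
    ≡⟨ det-cong n (M-offsets k r p) ⟩
  det n (λ a b → + shiftedFib m (r ℕ.+ col a ℕ.+ col b))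
    ≡⟨ det-offsetHankel r ⟩
  -1ℤ ^ (m ℕ.* r ℕ.+ n / 2) * (+ shiftedFib m (p ℕ.+ k)) ^ 2
    ≡⟨ cong (λ x → -1ℤ ^ (m ℕ.* r ℕ.+ n / 2) * (+ x) ^ 2) (F≡shiftedFib k (p ℕ.+ k) (pIndex p)) ⟨
  -1ℤ ^ (m ℕ.* r ℕ.+ n / 2) * (+ F n (+ p)) ^ 2 ∎
  where
  open ≡-Reasoning
  m n : ℕ
  m = suc k
  n = suc m
  open RecurrentHankel m (+_ ∘ shiftedFib m) (shiftedFib-rec m) (λ t t<m → cong +_ (delay-< m _ t t<m))
                       (cong +_ (shiftedFib-m m)) (p ℕ.+ k)
  pIndex : ∀ p → + p ≡ + (p ℕ.+ k) - + k
  pIndex p rewrite ℤP.pos-+ p k = lemma (+ p) (+ k)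
    where
    lemma : ∀ p k → p ≡ p + k - k
    lemma = solve-∀
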